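{- (a) For $t\ge 3$ and $1\le n_1\le\cdots\le n_t$, $crx_1(K_{n_1,\dots,n_t})=3$. (b) For $k,t\ge 2$ there exists $N=N(k,t)$ such that for all $n\ge N$, $crx_k(K_{t\times n})=2k$.
   Context: All graphs are finite and simple. $K_{n_1,\dots,n_t}$ is the complete $t$-partite graph with class sizes $n_1,\dots,n_t$, and $K_{t\times n}$ is the complete $t$-partite graph with every class of size $n$. For $k\ge1$ and a graph $G$ in which any $k$ vertices lie in a common cycle, $crx_k(G)$ is the minimum number of colours in an edge-colouring of $G$ such that every set of $k$ vertices is contained in a cycle whose edges have pairwise distinct colours. -}

module Defs where

open import Level using (0ℓ)
open import Data.Nat using (ℕ; _≤_)
open import Data.Fin using (Fin)
open import Data.Product using (Σ; _×_; _,_; proj₁; proj₂; ∃)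
open import Data.List using (List; []; _∷_; length; map)
open import Data.List.Relation.Unary.All using (All)
open import Data.List.Relation.Unary.Unique.Propositional using (Unique)
open import Data.List.Membership.Propositional using (_∈_)
open import Relation.Binary.PropositionalEquality using (_≡_)
open import Relation.Nullary using (¬_)

record Graph : Set₁ where
  field
    V      : Set
    Adj    : V → V → Set
    irrefl : ∀ v → ¬ Adj v v
    sym    : ∀ {u v} → Adj u v → Adj v u
open Graph public

completeMultipartite : (t : ℕ) → (Fin t → ℕ) → Graph
completeMultipartite t n = record
  { V      = Σ (Fin t) (λ i → Fin (n i))
  ; Adj    = λ x y → ¬ (proj₁ x ≡ proj₁ y)
  ; irrefl = λ v ne → ne Relation.Binary.PropositionalEquality.refl
  ; sym    = λ ne eq → ne (Relation.Binary.PropositionalEquality.sym eq)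
  }

completeBalanced : ℕ → ℕ → Graph
completeBalanced t n = completeMultipartite t (λ _ → n)

-- The edges (consecutive pairs, including the closing pair) of the cyclic
-- sequence v₀ v₁ … v_{l-1}: (v₀,v₁), …, (v_{l-2},v_{l-1}), (v_{l-1},v₀).
module _ {A : Set} where
  private
    closing : A → List A → List (A × A)
    closing first []           = []
    closing first (x ∷ [])     = (x , first) ∷ []
    closing first (x ∷ y ∷ r)  = (x , y) ∷ closing first (y ∷ r)

  cycleEdges : List A → List (A × A)
  cycleEdges []       = []
  cycleEdges (v ∷ vs) = closing v (v ∷ vs)

IsCycle : (G : Graph) → List (V G) → Set
IsCycle G vs = (3 ≤ length vs) × Unique vs × All (λ e → Adj G (proj₁ e) (proj₂ e)) (cycleEdges vs)

-- An edge-colouring of G with (at most) r colours: a symmetric colour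
-- assignment to pairs of vertices (only values on edges matter).
Colouring : Graph → ℕ → Set
Colouring G r = Σ (V G → V G → Fin r) (λ c → ∀ u v → c u v ≡ c v u)

Rainbow : (G : Graph) {r : ℕ} → Colouring G r → List (V G) → Set
Rainbow G (c , _) vs = Unique (map (λ e → c (proj₁ e) (proj₂ e)) (cycleEdges vs))

KRainbowCyclic : (G : Graph) (k : ℕ) {r : ℕ} → Colouring G r → Set
KRainbowCyclic G k col =
  (S : List (V G)) → length S ≡ k → Unique S →
  ∃ λ vs → IsCycle G vs × Rainbow G col vs × All (_∈ vs) S

CrxIs : Graph → ℕ → ℕ → Set
CrxIs G k r =
  (Σ (Colouring G r) (KRainbowCyclic G k)) ×
  (∀ r′ → Σ (Colouring G r′) (KRainbowCyclic G k) → r ≤ r′)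

-- (a) Colour an edge between classes i and j by ℓ(i) + ℓ(j) mod 3, where ℓ is 0 and 1 on the first
-- two classes and 2 on all others. Every vertex lies on a triangle through classes of levels 0, 1 and 2,
-- whose colours 1, 0, 2 are distinct, and no cycle has fewer than three edges.
--
-- (b) A cycle through k vertices of one class, which are pairwise non-adjacent, has at least 2k edges, so
-- 2k colours are needed. Conversely, let the position of a vertex within its class encode a type in the
-- Paley tournament on ℤ₇, two palette colours and a bit position, and colour an edge from the palette of
-- the endpoint of dominating type, choosing by that bit of the identifier of the other endpoint. Any two
-- types have a common dominator and distinct identifiers differ in some bit, so for distinct s, s′, any
-- class and any colours α, β there are many w in that class with c(s, w) = α and c(w, s′) = β. A rainbow
-- cycle of length 2k through any k vertices can then be threaded greedily, two fresh colours per joining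
-- vertex. Identifiers have about log n bits, so the encoding needs only O(log n) positions per class,
-- which are available once n is large.
module Submission where

open import Defs hiding (sym)
open import Data.Bool using (Bool; true; false; if_then_else_)
import Data.Bool as Bool
open import Data.Empty using (⊥-elim)
open import Data.Fin using (Fin; zero; suc; toℕ; fromℕ<; inject≤; combine) renaming (_≤_ to _≤ᶠ_)
import Data.Fin as Fin
open import Data.Fin.Properties using (toℕ<n; toℕ-fromℕ<; toℕ-injective; inject≤-injective; combine-injective; all?; any?)
open import Data.List using (List; []; _∷_; [_]; _++_; length; map; filter; drop; allFin; partition)
open import Data.List.Membership.Propositional using (_∈_; _∉_; find)
open import Data.List.Membership.Propositional.Properties using (∈-allFin; ∈-map⁻; ∈-filter⁺; ∈-++⁺ʳ)
import Data.List.Membership.DecPropositional as DecMembership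
open import Data.List.Properties using (length-map; length-++; length-tabulate; length-removeAt′; filter-++; map-++; ++-assoc)
open import Data.List.Relation.Binary.Subset.Propositional using (_⊆_)
open import Data.List.Relation.Unary.All as All using (All; []; _∷_)
open import Data.List.Relation.Unary.All.Properties
  using (¬All⇒Any¬; ¬Any⇒All¬; map⁺; partition-All) renaming (++⁺ to All-++⁺)
open import Data.List.Relation.Unary.Any using (here; there; index; _─_)
open import Data.List.Relation.Unary.AllPairs using ([]; _∷_)
open import Data.List.Relation.Unary.Unique.Propositional using (Unique)
import Data.List.Relation.Unary.Unique.Propositional.Properties as Unique
open import Data.Nat using (ℕ; zero; suc; _+_; _*_; _^_; _∸_; _≤_; _<_; z≤n; s≤s; NonZero; ⌊_/2⌋)
open import Data.Nat.DivMod
  using ( _mod_; _/_; _%_; m≡m%n+[m/n]*n; m%n<n; m/n*n≤m; m*n/n≡m; /-monoˡ-≤; [m+kn]%n≡m%n; m<n⇒m%n≡m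
        ; +-distrib-/-∣ʳ; m<n⇒m/n≡0)
open import Data.Nat.Divisibility using (n∣m*n)
open import Data.Nat.Properties
open import Data.Nat.Tactic.RingSolver using (solve-∀)
open import Data.Product using (Σ; _×_; _,_; proj₁; proj₂; ∃; ∃₂)
open import Data.Product.Properties using (≡-dec)
open import Function using (_∘_)
open import Level using (0ℓ)
open import Relation.Binary.Definitions using (DecidableEquality)
open import Relation.Binary.PropositionalEquality
  using (setoid; _≡_; _≢_; refl; sym; trans; cong; cong₂; subst; subst₂; ≢-sym; module ≡-Reasoning)
open import Relation.Nullary using (¬_; yes; no)
open import Relation.Nullary.Decidable using (from-yes; _×-dec_; _→-dec_)
open import Relation.Unary using (Pred; Decidable)

module _ {A : Set} where

  ∈-─ : ∀ {x y : A} {ys} (x∈ys : x ∈ ys) → y ∈ ys → y ≢ x → y ∈ (ys ─ x∈ys)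
  ∈-─ (here refl) (here refl) y≢x = ⊥-elim (y≢x refl)
  ∈-─ (here refl) (there y∈ys) _  = y∈ys
  ∈-─ (there _)   (here refl) _   = here refl
  ∈-─ (there x∈ys) (there y∈ys) y≢x = there (∈-─ x∈ys y∈ys y≢x)

  Unique∧⊆⇒length≤ : ∀ {xs ys : List A} → Unique xs → xs ⊆ ys → length xs ≤ length ys
  Unique∧⊆⇒length≤ [] _ = z≤n
  Unique∧⊆⇒length≤ {x ∷ _} {ys} (x∉xs ∷ u) xs⊆ys =
    subst (_ ≤_) (sym (length-removeAt′ ys (index x∈ys)))
      (s≤s (Unique∧⊆⇒length≤ u λ y∈xs →
        ∈-─ x∈ys (xs⊆ys (there y∈xs)) (λ y≡x → All.lookup x∉xs y∈xs (sym y≡x))))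
    where
    x∈ys : x ∈ ys
    x∈ys = xs⊆ys (here refl)

  module _ (_≟_ : DecidableEquality A) where
    open DecMembership _≟_ using (_∈?_)

    ∃∉-of-longer : ∀ {cs} (F : List A) → Unique cs → length F < length cs → ∃ λ c → c ∈ cs × c ∉ F
    ∃∉-of-longer {cs} F u F<cs with All.all? (_∈? F) cs
    ... | yes cs⊆F = ⊥-elim (<⇒≱ F<cs (Unique∧⊆⇒length≤ u (All.lookup cs⊆F)))
    ... | no cs⊈F  = find (¬All⇒Any¬ (_∈? F) cs cs⊈F)

  ∈-insert : ∀ {a x w : A} {xs} → a ∈ x ∷ xs → a ∈ x ∷ w ∷ xs
  ∈-insert (here a≡x)  = here a≡x
  ∈-insert (there a∈xs) = there (there a∈xs)

  Unique-insert : ∀ {w x : A} {xs} → w ∉ x ∷ xs → Unique (x ∷ xs) → Unique (x ∷ w ∷ xs)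
  Unique-insert w∉ (x∉xs ∷ u) = ((λ x≡w → w∉ (here (sym x≡w))) ∷ x∉xs) ∷ ¬Any⇒All¬ _ (w∉ ∘ there) ∷ u

length-allFin : ∀ r → length (allFin r) ≡ r
length-allFin r = length-tabulate {n = r} (λ i → i)

∃-fresh : ∀ {r} (used : List (Fin r)) → length used < r → ∃ λ γ → γ ∉ used
∃-fresh {r} used used<r =
  let γ , _ , γ∉used = ∃∉-of-longer Fin._≟_ used (Unique.allFin⁺ r)
                        (subst (length used <_) (sym (length-allFin r)) used<r)
  in γ , γ∉used

∃-fresh₂ : ∀ {r} (used : List (Fin r)) → Unique used → 2 + length used ≤ r →
           ∃₂ λ α β → Unique (α ∷ β ∷ used)
∃-fresh₂ used u 2+used≤r =
  let α , α∉ = ∃-fresh used (≤-trans (n≤1+n _) 2+used≤r)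
      β , β∉ = ∃-fresh (α ∷ used) 2+used≤r
  in α , β , Unique-insert β∉ (¬Any⇒All¬ used α∉ ∷ u)

module _ {A : Set} where
  open import Data.List.Relation.Binary.Permutation.Setoid (setoid A) public
    using (_↭_; ↭-trans; ↭-prep; ↭-reflexive)
  open import Data.List.Relation.Binary.Permutation.Setoid.Properties (setoid A) public
    using (Unique-resp-↭; ∈-resp-↭; xs↭ys⇒|xs|≡|ys|; shifts; ++-comm; partition-↭)

module _ {A : Set} where

  pathEdges : List A → List (A × A)
  pathEdges []          = []
  pathEdges (x ∷ [])    = []
  pathEdges (x ∷ y ∷ r) = (x , y) ∷ pathEdges (y ∷ r)

  lastOf : A → List A → A
  lastOf x []      = x
  lastOf _ (y ∷ r) = lastOf y r

  lastOf-∈ : ∀ x r → lastOf x r ∈ x ∷ r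
  lastOf-∈ x []      = here refl
  lastOf-∈ x (y ∷ r) = there (lastOf-∈ y r)

  length-pathEdges : ∀ x r → length (pathEdges (x ∷ r)) ≡ length r
  length-pathEdges x []      = refl
  length-pathEdges x (y ∷ r) = cong suc (length-pathEdges y r)

  -- closingEdges f xs reduces to the private helper closing f xs of cycleEdges in Defs.
  private
    closingEdges : A → List A → List (A × A)
    closingEdges f xs = drop 1 (cycleEdges (f ∷ xs))

    closingEdges-≡ : ∀ f x r → closingEdges f (x ∷ r) ≡ pathEdges (x ∷ r) ++ [ (lastOf x r , f) ]
    closingEdges-≡ f x []      = refl
    closingEdges-≡ f x (y ∷ r) = cong ((x , y) ∷_) (closingEdges-≡ f y r)

    map-proj₁-closingEdges : ∀ f xs → map proj₁ (closingEdges f xs) ≡ xs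
    map-proj₁-closingEdges f []          = refl
    map-proj₁-closingEdges f (x ∷ [])    = refl
    map-proj₁-closingEdges f (x ∷ y ∷ r) = cong (x ∷_) (map-proj₁-closingEdges f (y ∷ r))

    map-proj₂-closingEdges : ∀ f x r → map proj₂ (closingEdges f (x ∷ r)) ≡ r ++ [ f ]
    map-proj₂-closingEdges f x []      = refl
    map-proj₂-closingEdges f x (y ∷ r) = cong (y ∷_) (map-proj₂-closingEdges f y r)

  cycleEdges-∷∷ : ∀ w x r → cycleEdges (w ∷ x ∷ r) ≡ (w , x) ∷ pathEdges (x ∷ r) ++ [ (lastOf x r , w) ]
  cycleEdges-∷∷ w x r = cong ((w , x) ∷_) (closingEdges-≡ w x r)

  map-proj₁-cycleEdges : ∀ vs → map proj₁ (cycleEdges vs) ≡ vs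
  map-proj₁-cycleEdges []       = refl
  map-proj₁-cycleEdges (v ∷ vs) = map-proj₁-closingEdges v (v ∷ vs)

  map-proj₂-cycleEdges : ∀ v vs → map proj₂ (cycleEdges (v ∷ vs)) ≡ vs ++ [ v ]
  map-proj₂-cycleEdges v vs = map-proj₂-closingEdges v v vs

  length-cycleEdges : ∀ vs → length (cycleEdges vs) ≡ length vs
  length-cycleEdges vs = trans (sym (length-map proj₁ (cycleEdges vs))) (cong length (map-proj₁-cycleEdges vs))

module _ {A : Set} {P : Pred A 0ℓ} (P? : Decidable P) where

  count : List A → ℕ
  count xs = length (filter P? xs)

  count-∷ʳ : ∀ v xs → count (xs ++ [ v ]) ≡ count (v ∷ xs)
  count-∷ʳ v xs = begin
    length (filter P? (xs ++ [ v ]))           ≡⟨ cong length (filter-++ P? xs [ v ]) ⟩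
    length (filter P? xs ++ filter P? [ v ])   ≡⟨ length-++ (filter P? xs) ⟩
    count xs + count [ v ]                     ≡⟨ +-comm (count xs) (count [ v ]) ⟩
    count [ v ] + count xs                     ≡⟨ sym (length-++ (filter P? [ v ])) ⟩
    length (filter P? [ v ] ++ filter P? xs)   ≡⟨ cong length (sym (filter-++ P? [ v ] xs)) ⟩
    count (v ∷ xs)                             ∎
    where open ≡-Reasoning

  count-ends≤ : ∀ (es : List (A × A)) → All (λ e → ¬ (P (proj₁ e) × P (proj₂ e))) es →
                count (map proj₁ es) + count (map proj₂ es) ≤ length es
  count-ends≤ [] [] = z≤n
  count-ends≤ ((u , v) ∷ es) (¬both ∷ ok) with P? u | P? v
  ... | yes pu | yes pv = ⊥-elim (¬both (pu , pv))
  ... | yes _  | no _   = s≤s (count-ends≤ es ok)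
  ... | no _   | yes _  = subst (_≤ suc (length es)) (sym (+-suc _ _)) (s≤s (count-ends≤ es ok))
  ... | no _   | no _   = m≤n⇒m≤1+n (count-ends≤ es ok)

  count-cycle≤ : ∀ vs → All (λ e → ¬ (P (proj₁ e) × P (proj₂ e))) (cycleEdges vs) → count vs + count vs ≤ length vs
  count-cycle≤ []       _  = z≤n
  count-cycle≤ (v ∷ vs) ok = subst₂ _≤_ ends (length-cycleEdges (v ∷ vs)) (count-ends≤ (cycleEdges (v ∷ vs)) ok)
    where
    ends : count (map proj₁ (cycleEdges (v ∷ vs))) + count (map proj₂ (cycleEdges (v ∷ vs))) ≡
           count (v ∷ vs) + count (v ∷ vs)
    ends = cong₂ _+_ (cong count (map-proj₁-cycleEdges (v ∷ vs)))
                     (trans (cong count (map-proj₂-cycleEdges v vs)) (count-∷ʳ v vs))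

-- Lower bounds

Rainbow⇒length≤ : ∀ (G : Graph) {r} (col : Colouring G r) vs → Rainbow G col vs → length vs ≤ r
Rainbow⇒length≤ G {r} (c , _) vs rainbow =
  subst₂ _≤_ (trans (length-map _ (cycleEdges vs)) (length-cycleEdges vs)) (length-allFin r)
    (Unique∧⊆⇒length≤ rainbow (λ {γ} _ → ∈-allFin γ))

module _ (G : Graph) {r} (col : Colouring G r) where

  RainbowCyclic⇒3≤ : ∀ {k} → KRainbowCyclic G k col → (S : List (V G)) → length S ≡ k → Unique S → 3 ≤ r
  RainbowCyclic⇒3≤ cyclic S |S| uS with cyclic S |S| uS
  ... | vs , (3≤|vs| , _) , rainbow , _ = ≤-trans 3≤|vs| (Rainbow⇒length≤ G col vs rainbow)

  module _ {P : Pred (V G) 0ℓ} (P? : Decidable P) (independent : ∀ {u v} → Adj G u v → ¬ (P u × P v)) where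

    RainbowCyclic⇒2k≤ : ∀ {k} → KRainbowCyclic G k col →
                        (S : List (V G)) → length S ≡ k → Unique S → All P S → 2 * k ≤ r
    RainbowCyclic⇒2k≤ {k} cyclic S refl uS S⊆P with cyclic S refl uS
    ... | vs , (_ , _ , adjacent) , rainbow , S⊆vs = begin
      2 * k                   ≡⟨ cong (k +_) (+-identityʳ k) ⟩
      k + k                   ≤⟨ +-mono-≤ k≤count k≤count ⟩
      count P? vs + count P? vs ≤⟨ count-cycle≤ P? vs (All.map independent adjacent) ⟩
      length vs               ≤⟨ Rainbow⇒length≤ G col vs rainbow ⟩
      r                       ∎
      where
      open ≤-Reasoning
      k≤count : k ≤ count P? vs
      k≤count = Unique∧⊆⇒length≤ uS λ s∈S → ∈-filter⁺ P? (All.lookup S⊆vs s∈S) (All.lookup S⊆P s∈S)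

2k≤crx-balanced : ∀ {k t n} → k ≤ n → ∀ r →
                  Σ (Colouring (completeBalanced (suc t) n) r) (KRainbowCyclic (completeBalanced (suc t) n) k) → 2 * k ≤ r
2k≤crx-balanced {k} {t} {n} k≤n r (col , cyclic) =
  RainbowCyclic⇒2k≤ G col (λ v → proj₁ v Fin.≟ zero) (λ adj (pu , pv) → adj (trans pu (sym pv)))
    cyclic S |S| (Unique.map⁺ inClass0-injective (Unique.allFin⁺ k)) (map⁺ (All.universal (λ _ → refl) (allFin k)))
  where
  G : Graph
  G = completeBalanced (suc t) n
  inClass0 : Fin k → V G
  inClass0 i = zero , inject≤ i k≤n
  inClass0-injective : ∀ {i j} → inClass0 i ≡ inClass0 j → i ≡ j
  inClass0-injective eq = inject≤-injective k≤n k≤n _ _ (cong proj₂ eq)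
  S : List (V G)
  S = map inClass0 (allFin k)
  |S| : length S ≡ k
  |S| = trans (length-map inClass0 (allFin k)) (length-allFin k)

-- One vertex on a rainbow cycle

triangle : ∀ {t n} (x y z : V (completeMultipartite t n)) →
           proj₁ x ≢ proj₁ y → proj₁ y ≢ proj₁ z → proj₁ z ≢ proj₁ x →
           IsCycle (completeMultipartite t n) (x ∷ y ∷ z ∷ [])
triangle x y z xy yz zx =
  s≤s (s≤s (s≤s z≤n)) ,
  ((xy ∘ cong proj₁) ∷ (zx ∘ sym ∘ cong proj₁) ∷ []) ∷ ((yz ∘ cong proj₁) ∷ []) ∷ [] ∷ [] ,
  xy ∷ yz ∷ zx ∷ []

crx₁-multipartite : ∀ t (n : Fin t → ℕ) → 3 ≤ t → (∀ i → 1 ≤ n i) → CrxIs (completeMultipartite t n) 1 3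
crx₁-multipartite 0 _ () _
crx₁-multipartite 1 _ (s≤s ()) _
crx₁-multipartite 2 _ (s≤s (s≤s ())) _
crx₁-multipartite t@(suc (suc (suc _))) n _ n≥1 = (colouring , cyclic) , lower
  where
  G : Graph
  G = completeMultipartite t n

  level : Fin t → ℕ
  level zero          = 0
  level (suc zero)    = 1
  level (suc (suc _)) = 2

  colouring : Colouring G 3
  colouring = (λ u v → (level (proj₁ u) + level (proj₁ v)) mod 3) ,
              (λ u v → cong (_mod 3) (+-comm (level (proj₁ u)) (level (proj₁ v))))

  vertexOf : Fin t → V G
  vertexOf i = i , fromℕ< (n≥1 i)

  cyclic : KRainbowCyclic G 1 colouring
  cyclic (u@(zero , _) ∷ []) refl _ =
    (u ∷ vertexOf (suc zero) ∷ vertexOf (suc (suc zero)) ∷ []) , triangle _ _ _ (λ ()) (λ ()) (λ ()) ,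
    ((λ ()) ∷ (λ ()) ∷ []) ∷ ((λ ()) ∷ []) ∷ [] ∷ [] , here refl ∷ []
  cyclic (u@(suc zero , _) ∷ []) refl _ =
    (u ∷ vertexOf zero ∷ vertexOf (suc (suc zero)) ∷ []) , triangle _ _ _ (λ ()) (λ ()) (λ ()) ,
    ((λ ()) ∷ (λ ()) ∷ []) ∷ ((λ ()) ∷ []) ∷ [] ∷ [] , here refl ∷ []
  cyclic (u@(suc (suc _) , _) ∷ []) refl _ =
    (u ∷ vertexOf zero ∷ vertexOf (suc zero) ∷ []) , triangle _ _ _ (λ ()) (λ ()) (λ ()) ,
    ((λ ()) ∷ (λ ()) ∷ []) ∷ ((λ ()) ∷ []) ∷ [] ∷ [] , here refl ∷ []

  lower : ∀ r → Σ (Colouring G r) (KRainbowCyclic G 1) → 3 ≤ r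
  lower r (col , cyclic′) = RainbowCyclic⇒3≤ G col cyclic′ (vertexOf zero ∷ []) refl ([] ∷ [])

-- Binary digits and logarithmic growth

odd : ℕ → Bool
odd zero          = false
odd (suc zero)    = true
odd (suc (suc n)) = odd n

bit : ℕ → ℕ → Bool
bit zero    x = odd x
bit (suc j) x = bit j ⌊ x /2⌋

odd-⌊/2⌋-injective : ∀ x y → odd x ≡ odd y → ⌊ x /2⌋ ≡ ⌊ y /2⌋ → x ≡ y
odd-⌊/2⌋-injective zero          zero          _ _ = refl
odd-⌊/2⌋-injective zero          (suc zero)    () _
odd-⌊/2⌋-injective zero          (suc (suc y)) _ ()
odd-⌊/2⌋-injective (suc zero)    zero          () _
odd-⌊/2⌋-injective (suc zero)    (suc zero)    _ _ = refl
odd-⌊/2⌋-injective (suc zero)    (suc (suc y)) _ ()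
odd-⌊/2⌋-injective (suc (suc x)) zero          _ ()
odd-⌊/2⌋-injective (suc (suc x)) (suc zero)    _ ()
odd-⌊/2⌋-injective (suc (suc x)) (suc (suc y)) odd≡ half≡ =
  cong (λ z → suc (suc z)) (odd-⌊/2⌋-injective x y odd≡ (suc-injective half≡))

⌊/2⌋-<-^ : ∀ {x} L → x < 2 ^ suc L → ⌊ x /2⌋ < 2 ^ L
⌊/2⌋-<-^ {x} L x<2^1+L =
  subst (suc ⌊ x /2⌋ ≤_) (sym (n≡⌈n+n/2⌉ (2 ^ L)))
    (⌈n/2⌉-mono (subst (x <_) (cong (2 ^ L +_) (+-identityʳ (2 ^ L))) x<2^1+L))

bits-separate : ∀ L {x y} → x < 2 ^ L → y < 2 ^ L → x ≢ y → ∃ λ j → j < L × bit j x ≢ bit j y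
bits-separate zero (s≤s z≤n) (s≤s z≤n) x≢y = ⊥-elim (x≢y refl)
bits-separate (suc L) {x} {y} x< y< x≢y with odd x Bool.≟ odd y
... | no odd≢ = 0 , s≤s z≤n , odd≢
... | yes odd≡ with bits-separate L (⌊/2⌋-<-^ L x<) (⌊/2⌋-<-^ L y<) (x≢y ∘ odd-⌊/2⌋-injective x y odd≡)
...   | j , j<L , bit≢ = suc j , s≤s j<L , bit≢

n<2^n : ∀ a → a < 2 ^ a
n<2^n zero    = s≤s z≤n
n<2^n (suc a) = begin-strict
  suc a               <⟨ m<n+m (suc a) (s≤s z≤n) ⟩
  suc a + suc a       ≤⟨ +-mono-≤ (n<2^n a) (n<2^n a) ⟩
  2 ^ a + 2 ^ a       ≡⟨ cong (2 ^ a +_) (sym (+-identityʳ (2 ^ a))) ⟩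
  2 ^ suc a           ∎
  where open ≤-Reasoning

linear≤2^ : ∀ D q → (D + D) + (D + D) ≤ q → D * suc q ≤ 2 ^ q
linear≤2^ D q q₀≤q = subst (λ p → D * suc p ≤ 2 ^ p) (m∸n+n≡m q₀≤q) (fromBase (q ∸ q₀))
  where
  open ≤-Reasoning
  d q₀ : ℕ
  d  = D + D
  q₀ = d + d

  base : D * suc q₀ ≤ 2 ^ q₀
  base = begin
    D * suc (d + d)            ≤⟨ m≤m+n (D * suc (d + d)) (suc (D + d)) ⟩
    D * suc (d + d) + suc (D + d) ≡⟨ square D ⟩
    suc d * suc d              ≤⟨ *-mono-≤ (n<2^n d) (n<2^n d) ⟩
    2 ^ d * 2 ^ d              ≡⟨ sym (^-distribˡ-+-* 2 d d) ⟩
    2 ^ q₀                     ∎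
    where
    square : ∀ D → D * suc ((D + D) + (D + D)) + suc (D + (D + D)) ≡ suc (D + D) * suc (D + D)
    square = solve-∀

  step : ∀ {p} → D * suc p ≤ 2 ^ p → D * suc (suc p) ≤ 2 ^ suc p
  step {p} ih = begin
    D * suc (suc p)            ≡⟨ *-suc D (suc p) ⟩
    D + D * suc p              ≤⟨ +-mono-≤ (≤-trans (m≤m*n D (suc p)) ih) ih ⟩
    2 ^ p + 2 ^ p              ≡⟨ cong (2 ^ p +_) (sym (+-identityʳ (2 ^ p))) ⟩
    2 ^ suc p                  ∎

  fromBase : ∀ o → D * suc (o + q₀) ≤ 2 ^ (o + q₀)
  fromBase zero    = base
  fromBase (suc o) = step (fromBase o)

n<[1+n/d]*d : ∀ n d .{{_ : NonZero d}} → n < suc (n / d) * d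
n<[1+n/d]*d n d = subst (_< suc (n / d) * d) (sym (m≡m%n+[m/n]*n n d)) (+-monoˡ-< (n / d * d) (m%n<n n d))

∃-bitLength : ∀ C T .{{_ : NonZero C}} → ∃ λ N → ∀ n → N ≤ n → ∃ λ L → n * T ≤ 2 ^ L × L * C ≤ n
∃-bitLength C T = q₀ * C , λ n N≤n → n / C , bits n N≤n , m/n*n≤m n C
  where
  open ≤-Reasoning
  D q₀ : ℕ
  D  = C * T
  q₀ = (D + D) + (D + D)

  bits : ∀ n → q₀ * C ≤ n → n * T ≤ 2 ^ (n / C)
  bits n N≤n = begin
    n * T                ≤⟨ *-monoˡ-≤ T (<⇒≤ (n<[1+n/d]*d n C)) ⟩
    suc (n / C) * C * T  ≡⟨ reorder (suc (n / C)) C T ⟩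
    D * suc (n / C)      ≤⟨ linear≤2^ D (n / C) (subst (_≤ n / C) (m*n/n≡m q₀ C) (/-monoˡ-≤ C N≤n)) ⟩
    2 ^ (n / C)          ∎
    where
    reorder : ∀ a C T → a * C * T ≡ C * T * a
    reorder = solve-∀

-- The Paley tournament on ℤ₇: y → x iff x − y is a non-zero square mod 7, that is 1, 2 or 4.
dominates : Fin 7 → Fin 7 → Bool
dominates y x = isSquare ((7 + toℕ x ∸ toℕ y) % 7)
  where
  isSquare : ℕ → Bool
  isSquare 1 = true
  isSquare 2 = true
  isSquare 4 = true
  isSquare _ = false

dominates-asym : ∀ y x → dominates y x ≡ true → dominates x y ≡ false
dominates-asym = from-yes (all? λ y → all? λ x → (dominates y x Bool.≟ true) →-dec (dominates x y Bool.≟ false))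

commonDominator : ∀ x x′ → ∃ λ y → dominates y x ≡ true × dominates y x′ ≡ true
commonDominator =
  from-yes (all? λ x → all? λ x′ → any? λ y → (dominates y x Bool.≟ true) ×-dec (dominates y x′ Bool.≟ true))

mod-digit : ∀ {d} .{{_ : NonZero d}} (r : Fin d) q → (toℕ r + q * d) mod d ≡ r
mod-digit {d} r q = toℕ-injective (trans (toℕ-fromℕ< _) (trans ([m+kn]%n≡m%n (toℕ r) q d) (m<n⇒m%n≡m (toℕ<n r))))

div-digit : ∀ {d} .{{_ : NonZero d}} (r : Fin d) q → (toℕ r + q * d) / d ≡ q
div-digit {d} r q = trans (+-distrib-/-∣ʳ (toℕ r) (n∣m*n q)) (cong₂ _+_ (m<n⇒m/n≡0 (toℕ<n r)) (m*n/n≡m q d))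

digit< : ∀ {d Q q} (r : Fin d) → q < Q → toℕ r + q * d < Q * d
digit< {d} {Q} {q} r q<Q = ≤-trans (+-monoˡ-< (q * d) (toℕ<n r)) (*-monoˡ-≤ d q<Q)

if-split : ∀ {A : Set} {b b′ : Bool} (α β : A) → b ≢ b′ →
           ∃₂ λ x y → (if b then y else x) ≡ α × (if b′ then y else x) ≡ β
if-split {b = true}  {true}  α β b≢b′ = ⊥-elim (b≢b′ refl)
if-split {b = true}  {false} α β _    = β , α , refl , refl
if-split {b = false} {true}  α β _    = α , β , refl , refl
if-split {b = false} {false} α β b≢b′ = ⊥-elim (b≢b′ refl)

-- Rainbow cycles in balanced complete multipartite graphs

module Balanced (t-2 k-2 n : ℕ) where

  t k m : ℕ
  t = 2 + t-2
  k = 2 + k-2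
  m = 2 * k

  G : Graph
  G = completeBalanced t n

  Vertex : Set
  Vertex = V G

  class : Vertex → Fin t
  class = proj₁

  Extendable : Colouring G m → Set
  Extendable (c , _) = ∀ {s s′} → s ≢ s′ → ∀ j (α β : Fin m) (F : List Vertex) → length F < m →
                       ∃ λ w → class w ≡ j × w ∉ F × c s w ≡ α × c w s′ ≡ β

  data Link : Set where
    via    : Fin t → Link
    direct : Fin m → Link

  Plan : Set
  Plan = List (Vertex × Link)

  anchors : Plan → List Vertex
  anchors = map proj₁

  reserved : Plan → List (Fin m)
  reserved []                    = []
  reserved ((_ , via _)    ∷ R) = reserved R
  reserved ((_ , direct γ) ∷ R) = γ ∷ reserved R

  cost : Plan → ℕ
  cost []                    = 2
  cost ((_ , via _)    ∷ R) = 2 + cost R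
  cost ((_ , direct _) ∷ R) = 1 + cost R

  length<cost : ∀ R → length R < cost R
  length<cost []                    = s≤s z≤n
  length<cost ((_ , via _)    ∷ R) = s≤s (m≤n⇒m≤1+n (length<cost R))
  length<cost ((_ , direct _) ∷ R) = s≤s (length<cost R)

  length-reserved≤ : ∀ R → length (reserved R) ≤ length R
  length-reserved≤ []                    = z≤n
  length-reserved≤ ((_ , via _)    ∷ R) = m≤n⇒m≤1+n (length-reserved≤ R)
  length-reserved≤ ((_ , direct _) ∷ R) = s≤s (length-reserved≤ R)

  joinVia : Fin t → List Vertex → Plan → Plan
  joinVia j []       R = R
  joinVia j (x ∷ xs) R = (x , via j) ∷ joinVia j xs R

  anchors-joinVia : ∀ j xs R ys → anchors (joinVia j xs R) ++ ys ≡ xs ++ anchors R ++ ys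
  anchors-joinVia j []       R ys = refl
  anchors-joinVia j (x ∷ xs) R ys = cong (x ∷_) (anchors-joinVia j xs R ys)

  reserved-joinVia : ∀ j xs R → reserved (joinVia j xs R) ≡ reserved R
  reserved-joinVia j []       R = refl
  reserved-joinVia j (x ∷ xs) R = reserved-joinVia j xs R

  cost-joinVia : ∀ j xs R → cost (joinVia j xs R) ≡ length xs + length xs + cost R
  cost-joinVia j []       R = refl
  cost-joinVia j (x ∷ xs) R =
    cong suc (trans (cong suc (cost-joinVia j xs R)) (cong (_+ cost R) (sym (+-suc (length xs) (length xs)))))

  partner : Vertex → Vertex
  partner (zero  , a) = suc zero , a
  partner (suc _ , a) = zero , a

  ≢partner : ∀ s → s ≢ partner s
  ≢partner (zero  , a) ()
  ≢partner (suc _ , a) ()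

  inClass0? : Decidable (λ v → class v ≡ zero)
  inClass0? v = class v Fin.≟ zero

  1≢class : ∀ {i : Fin t} → i ≡ zero → suc zero ≢ i
  1≢class refl ()

  3≤m : 3 ≤ m
  3≤m = s≤s (s≤s (≤-trans (s≤s z≤n) (m≤n+m _ k-2)))

  module Threading (col : Colouring G m) (extend : Extendable col) where

    c : Vertex → Vertex → Fin m
    c = proj₁ col

    colours : List (Vertex × Vertex) → List (Fin m)
    colours = map (λ e → c (proj₁ e) (proj₂ e))

    Edge : Vertex × Vertex → Set
    Edge e = Adj G (proj₁ e) (proj₂ e)

    RainbowCycleThrough : List Vertex → Set
    RainbowCycleThrough S = ∃ λ vs → IsCycle G vs × Rainbow G col vs × All (_∈ vs) S

    Follows : Fin t → Vertex → Plan → Set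
    Follows j₀ h []                    = j₀ ≢ class h
    Follows j₀ h ((x , via j)    ∷ R) = (j ≢ class x × j ≢ class h) × Follows j₀ x R
    Follows j₀ h ((x , direct γ) ∷ R) = (Adj G x h × c x h ≡ γ) × Follows j₀ x R

    -- The path head ∷ rest is built backwards from its start vertex lastOf head rest. Each anchor of R
    -- is still to be joined to its predecessor as its link prescribes, and at the end the start is
    -- rejoined through a new vertex of class j₀; cost R counts the edges still to be laid.
    record Thread (S : List Vertex) (j₀ : Fin t) (R : Plan) : Set where
      field
        head     : Vertex
        rest     : List Vertex
        follows  : Follows j₀ head R
        closable : j₀ ≢ class (lastOf head rest)
        distinct : Unique (anchors R ++ head ∷ rest)
        covers   : S ⊆ anchors R ++ head ∷ rest
        adjacent : All Edge (pathEdges (head ∷ rest))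
        rainbow  : Unique (reserved R ++ colours (pathEdges (head ∷ rest)))
        edges    : length rest + cost R ≡ m

    length-colours : ∀ h r → length (colours (pathEdges (h ∷ r))) ≡ length r
    length-colours h r = trans (length-map _ (pathEdges (h ∷ r))) (length-pathEdges h r)

    close : ∀ {S j₀} → Thread S j₀ [] → RainbowCycleThrough S
    close record { rest = [] ; edges = edges } = ⊥-elim (<⇒≢ 3≤m edges)
    close {S} {j₀} th@record { head = h ; rest = y ∷ r } =
      let α , β , αβ-fresh = ∃-fresh₂ used rainbow (≤-reflexive (trans (cong (2 +_) (length-colours h (y ∷ r))) 3+r≡m))
          w , w∈j₀ , w∉ , c[e,w]≡α , c[w,h]≡β = extend e≢h j₀ α β (h ∷ y ∷ r) (≤-reflexive 3+r≡m)
      in cycleThrough w w∈j₀ w∉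
           (subst₂ (λ a b → Unique (b ∷ used ++ [ a ])) (sym c[e,w]≡α) (sym c[w,h]≡β)
             (Unique-resp-↭ (++-comm [ α ] (β ∷ used)) αβ-fresh))
      where
      open Thread th
      e : Vertex
      e = lastOf y r
      used : List (Fin m)
      used = colours (pathEdges (h ∷ y ∷ r))

      3+r≡m : 3 + length r ≡ m
      3+r≡m = trans (+-comm 2 (suc (length r))) edges

      e≢h : e ≢ h
      e≢h e≡h = Unique.Unique[x∷xs]⇒x∉xs distinct (subst (_∈ y ∷ r) e≡h (lastOf-∈ y r))

      cycleThrough : ∀ w → class w ≡ j₀ → w ∉ h ∷ y ∷ r → Unique (c w h ∷ used ++ [ c e w ]) →
                     RainbowCycleThrough S
      cycleThrough w w∈j₀ w∉ closedRainbow =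
        (w ∷ h ∷ y ∷ r) , (s≤s (s≤s (s≤s z≤n)) , ¬Any⇒All¬ _ w∉ ∷ distinct , cycleAdjacent) , cycleRainbow ,
        All.tabulate (there ∘ covers)
        where
        cycleAdjacent : All Edge (cycleEdges (w ∷ h ∷ y ∷ r))
        cycleAdjacent = subst (All Edge) (sym (cycleEdges-∷∷ w h (y ∷ r)))
          ((λ eq → follows (trans (sym w∈j₀) eq)) ∷
           All-++⁺ adjacent ((λ eq → closable (sym (trans eq w∈j₀))) ∷ []))
        cycleRainbow : Unique (colours (cycleEdges (w ∷ h ∷ y ∷ r)))
        cycleRainbow = subst Unique
          (sym (trans (cong colours (cycleEdges-∷∷ w h (y ∷ r))) (cong (c w h ∷_) (map-++ _ (pathEdges (h ∷ y ∷ r)) _))))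
          closedRainbow

    advance-direct : ∀ {S j₀ x γ R} → Thread S j₀ ((x , direct γ) ∷ R) → Thread S j₀ R
    advance-direct {x = x} {γ} {R} th = record
      { head     = x
      ; rest     = head ∷ rest
      ; follows  = proj₂ follows
      ; closable = closable
      ; distinct = Unique-resp-↭ (shifts [ x ] (anchors R)) distinct
      ; covers   = λ s∈S → ∈-resp-↭ (shifts [ x ] (anchors R)) (covers s∈S)
      ; adjacent = x~head ∷ adjacent
      ; rainbow  = subst (λ a → Unique (reserved R ++ a ∷ colours (pathEdges (head ∷ rest)))) (sym c[x,head]≡γ)
                     (Unique-resp-↭ (shifts [ γ ] (reserved R)) rainbow)
      ; edges    = trans (sym (+-suc (length rest) (cost R))) edges
      }
      where
      open Thread th
      x~head : Adj G x head
      x~head = proj₁ (proj₁ follows)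
      c[x,head]≡γ : c x head ≡ γ
      c[x,head]≡γ = proj₂ (proj₁ follows)

    advance-via : ∀ {S j₀ x j R} → Thread S j₀ ((x , via j) ∷ R) → Thread S j₀ R
    advance-via {x = x} {j} {R} th =
      let α , β , αβ-fresh = ∃-fresh₂ (reserved R ++ cs) rainbow colourBudget
          w , w∈j , w∉ , c[x,w]≡α , c[w,head]≡β = extend x≢head j α β (x ∷ anchors R ++ head ∷ rest) vertexBudget
      in record
      { head     = x
      ; rest     = w ∷ head ∷ rest
      ; follows  = proj₂ follows
      ; closable = closable
      ; distinct = Unique-resp-↭ (shifts (x ∷ w ∷ []) (anchors R)) (Unique-insert w∉ distinct)
      ; covers   = λ s∈S → ∈-resp-↭ (shifts (x ∷ w ∷ []) (anchors R)) (∈-insert (covers s∈S))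
      ; adjacent = (λ eq → j≢x (trans (sym w∈j) (sym eq))) ∷ (λ eq → j≢head (trans (sym w∈j) eq)) ∷ adjacent
      ; rainbow  = subst₂ (λ a b → Unique (reserved R ++ a ∷ b ∷ cs)) (sym c[x,w]≡α) (sym c[w,head]≡β)
                     (Unique-resp-↭ (shifts (α ∷ β ∷ []) (reserved R)) αβ-fresh)
      ; edges    = trans (+-suc² (length rest) (cost R)) edges
      }
      where
      open Thread th
      open ≤-Reasoning
      +-suc² : ∀ a b → 2 + a + b ≡ a + (2 + b)
      +-suc² = solve-∀
      cs : List (Fin m)
      cs = colours (pathEdges (head ∷ rest))
      j≢x : j ≢ class x
      j≢x = proj₁ (proj₁ follows)
      j≢head : j ≢ class head
      j≢head = proj₂ (proj₁ follows)

      x≢head : x ≢ head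
      x≢head x≡head = Unique.Unique[x∷xs]⇒x∉xs distinct (∈-++⁺ʳ (anchors R) (here x≡head))

      colourBudget : 2 + length (reserved R ++ cs) ≤ m
      colourBudget = begin
        2 + length (reserved R ++ cs)           ≡⟨ cong (2 +_) (length-++ (reserved R)) ⟩
        2 + (length (reserved R) + length cs)   ≤⟨ +-monoʳ-≤ 2 (+-mono-≤ reserved≤cost (≤-reflexive (length-colours head rest))) ⟩
        2 + (cost R + length rest)              ≡⟨ reorder (cost R) (length rest) ⟩
        length rest + (2 + cost R)              ≡⟨ edges ⟩
        m                                       ∎
        where
        reserved≤cost : length (reserved R) ≤ cost R
        reserved≤cost = ≤-trans (length-reserved≤ R) (<⇒≤ (length<cost R))
        reorder : ∀ a b → 2 + (a + b) ≡ b + (2 + a)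
        reorder = solve-∀

      vertexBudget : length (x ∷ anchors R ++ head ∷ rest) < m
      vertexBudget = begin-strict
        length (x ∷ anchors R ++ head ∷ rest) ≡⟨ cong suc (trans (length-++ (anchors R)) (cong (_+ _) (length-map proj₁ R))) ⟩
        suc (length R + suc (length rest))    ≡⟨ reorder (length R) (length rest) ⟩
        length R + (2 + length rest)          <⟨ +-monoˡ-< (2 + length rest) (length<cost R) ⟩
        cost R + (2 + length rest)            ≡⟨ reorder′ (cost R) (length rest) ⟩
        length rest + (2 + cost R)            ≡⟨ edges ⟩
        m                                     ∎
        where
        reorder : ∀ a b → suc (a + suc b) ≡ a + (2 + b)
        reorder = solve-∀
        reorder′ : ∀ a b → a + (2 + b) ≡ b + (2 + a)
        reorder′ = solve-∀

    thread : ∀ {S j₀} R → Thread S j₀ R → RainbowCycleThrough S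
    thread []                    th = close th
    thread ((_ , via _)    ∷ R) th = thread R (advance-via th)
    thread ((_ , direct _) ∷ R) th = thread R (advance-direct th)

    extend₁ : ∀ s j (γ : Fin m) (F : List Vertex) → length F < m → ∃ λ w → class w ≡ j × w ∉ F × c w s ≡ γ
    extend₁ s j γ F |F|<m =
      let w , w∈j , w∉ , c[s,w]≡γ , _ = extend (≢partner s) j γ γ F |F|<m
      in w , w∈j , w∉ , trans (proj₂ col w s) c[s,w]≡γ

    follows-joinVia : ∀ {j₀} j h xs R → j ≢ class h → All (λ x → j ≢ class x) xs → Follows j₀ (lastOf h xs) R →
                      Follows j₀ h (joinVia j xs R)
    follows-joinVia j h []       R _   []           f = f
    follows-joinVia j h (x ∷ xs) R j≢h (j≢x ∷ j≢xs) f = (j≢x , j≢h) , follows-joinVia j x xs R j≢x j≢xs f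

    cycleAvoiding : ∀ j (T : List Vertex) → length T ≡ k → Unique T → All (λ x → j ≢ class x) T →
                    RainbowCycleThrough T
    cycleAvoiding j (x ∷ xs@(_ ∷ _)) |T| uT j≢T@(j≢x ∷ j≢xs) = thread (joinVia j xs []) record
      { head     = x
      ; rest     = []
      ; follows  = follows-joinVia j x xs [] j≢x j≢xs (All.lookup j≢T (lastOf-∈ x xs))
      ; closable = j≢x
      ; distinct = subst Unique (sym (anchors-joinVia j xs [] [ x ])) (Unique-resp-↭ (++-comm [ x ] xs) uT)
      ; covers   = λ {s} s∈T → subst (s ∈_) (sym (anchors-joinVia j xs [] [ x ])) (∈-resp-↭ (++-comm [ x ] xs) s∈T)
      ; adjacent = []
      ; rainbow  = subst (λ cs → Unique (cs ++ [])) (sym (reserved-joinVia j xs [])) []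
      ; edges    = trans (cost-joinVia j xs []) (trans (cong (λ l → l + l + 2) (suc-injective |T|)) (count-edges k-2))
      }
      where
      count-edges : ∀ a → suc a + suc a + 2 ≡ 2 * (2 + a)
      count-edges = solve-∀

    -- The cycle b₀ ⋯ b* a₀ ⋯ a* y ⋯ b₀ joins the bᵢ through class 0 and the aᵢ through class 1. The edges
    -- b* a₀ and a* y have their colours fixed in advance, and the extra vertex y of class 1 lets the cycle
    -- return to b₀ through class 0 even when b₀ lies in class 1.
    cycleAcross : ∀ a₀ as b₀ bs → length (a₀ ∷ as) + length (b₀ ∷ bs) ≡ k → Unique ((a₀ ∷ as) ++ b₀ ∷ bs) →
                  All (λ a → class a ≡ zero) (a₀ ∷ as) → All (λ b → class b ≢ zero) (b₀ ∷ bs) →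
                  RainbowCycleThrough ((a₀ ∷ as) ++ b₀ ∷ bs)
    cycleAcross a₀ as b₀ bs |A|+|B| uT A⊆0 B⊆¬0 =
      let δ , δ∉ = ∃-fresh [ γ₀ ] (≤-trans (s≤s (s≤s z≤n)) 3≤m)
          y , y∈1 , y∉T , c[y,a*]≡δ = extend₁ a* (suc zero) δ T |T|<m
      in thread (plan δ y) (start δ y (λ γ₀≡δ → δ∉ (here (sym γ₀≡δ))) y∈1 y∉T c[y,a*]≡δ)
      where
      A B T : List Vertex
      A = a₀ ∷ as
      B = b₀ ∷ bs
      T = A ++ B
      a* b* : Vertex
      a* = lastOf a₀ as
      b* = lastOf b₀ bs
      γ₀ : Fin m
      γ₀ = c a₀ b*

      |T|<m : length T < m
      |T|<m = subst (_< m) (sym (trans (length-++ A) |A|+|B|)) (m<m+n k (s≤s z≤n))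

      plan : Fin m → Vertex → Plan
      plan δ y = joinVia zero bs ((a₀ , direct γ₀) ∷ joinVia (suc zero) as ((y , direct δ) ∷ []))

      start : ∀ δ y → γ₀ ≢ δ → class y ≡ suc zero → y ∉ T → c y a* ≡ δ → Thread T zero (plan δ y)
      start δ y γ₀≢δ y∈1 y∉T c[y,a*]≡δ = record
        { head     = b₀
        ; rest     = []
        ; follows  = follows-joinVia zero b₀ bs _ (≢-sym (All.head B⊆¬0)) (All.map ≢-sym (All.tail B⊆¬0))
                       ((a₀~b* , refl) ,
                        follows-joinVia (suc zero) a₀ as _ (1≢class (All.head A⊆0)) (All.map 1≢class (All.tail A⊆0))
                          ((y~a* , c[y,a*]≡δ) , λ 0≡y → 1≢class (sym (trans 0≡y y∈1)) refl))
        ; closable = ≢-sym (All.head B⊆¬0)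
        ; distinct = subst Unique (sym anchors≡) (Unique-resp-↭ σ (¬Any⇒All¬ T y∉T ∷ uT))
        ; covers   = λ {s} s∈T → subst (s ∈_) (sym anchors≡) (∈-resp-↭ σ (there s∈T))
        ; adjacent = []
        ; rainbow  = subst (λ cs → Unique (cs ++ [])) (sym reserved≡) ((γ₀≢δ ∷ []) ∷ [] ∷ [])
        ; edges    = trans (cost-joinVia zero bs _)
                       (trans (cong (λ l → length bs + length bs + suc l) (cost-joinVia (suc zero) as _))
                         (trans (count-edges (length as) (length bs)) (cong (2 *_) |A|+|B|)))
        }
        where
        a₀~b* : Adj G a₀ b*
        a₀~b* eq = All.lookup B⊆¬0 (lastOf-∈ b₀ bs) (trans (sym eq) (All.head A⊆0))

        y~a* : Adj G y a*
        y~a* eq = 1≢class (All.lookup A⊆0 (lastOf-∈ a₀ as)) (trans (sym y∈1) eq)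

        anchors≡ : anchors (plan δ y) ++ [ b₀ ] ≡ bs ++ a₀ ∷ as ++ y ∷ b₀ ∷ []
        anchors≡ = trans (anchors-joinVia zero bs _ [ b₀ ])
                         (cong (λ l → bs ++ a₀ ∷ l) (anchors-joinVia (suc zero) as _ [ b₀ ]))

        σ : y ∷ T ↭ bs ++ a₀ ∷ as ++ y ∷ b₀ ∷ []
        σ = ↭-trans (↭-prep y (++-comm A B))
              (↭-trans (++-comm (y ∷ b₀ ∷ []) (bs ++ A)) (↭-reflexive (++-assoc bs A (y ∷ b₀ ∷ []))))

        reserved≡ : reserved (plan δ y) ≡ γ₀ ∷ δ ∷ []
        reserved≡ = trans (reserved-joinVia zero bs _) (cong (γ₀ ∷_) (reserved-joinVia (suc zero) as _))

        count-edges : ∀ a b → b + b + suc (a + a + 3) ≡ 2 * (suc a + suc b)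
        count-edges = solve-∀

    rainbowCycle-⊆ : ∀ {S T} → S ⊆ T → RainbowCycleThrough T → RainbowCycleThrough S
    rainbowCycle-⊆ S⊆T (vs , cycle , rainbow , T⊆vs) = vs , cycle , rainbow , All.tabulate (All.lookup T⊆vs ∘ S⊆T)

    rainbowCyclic : KRainbowCyclic G k col
    rainbowCyclic S |S| uS with partition inClass0? S | partition-↭ inClass0? S | partition-All inClass0? S
    ... | as , bs | σ | A⊆0 , B⊆¬0 =
      rainbowCycle-⊆ (∈-resp-↭ σ) (split as bs (trans (sym (xs↭ys⇒|xs|≡|ys| σ)) |S|) (Unique-resp-↭ σ uS) A⊆0 B⊆¬0)
      where
      split : ∀ as bs → length (as ++ bs) ≡ k → Unique (as ++ bs) →
              All (λ a → class a ≡ zero) as → All (λ b → class b ≢ zero) bs → RainbowCycleThrough (as ++ bs)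
      split []         bs       |T| uT _   B⊆¬0 = cycleAvoiding zero bs |T| uT (All.map ≢-sym B⊆¬0)
      split as@(_ ∷ _) []       |T| uT A⊆0 _    =
        cycleAvoiding (suc zero) (as ++ []) |T| uT (All-++⁺ (All.map 1≢class A⊆0) [])
      split (a₀ ∷ as)  (b₀ ∷ bs) |T| uT A⊆0 B⊆¬0 =
        cycleAcross a₀ as b₀ bs (trans (sym (length-++ (a₀ ∷ as))) |T|) uT A⊆0 B⊆¬0

  module TournamentColouring (L : ℕ) (ids<2^L : n * t ≤ 2 ^ L) (room : L * m * m * 7 * m ≤ n) where

    ident : Vertex → ℕ
    ident v = toℕ (combine (proj₂ v) (proj₁ v))

    ident<2^L : ∀ v → ident v < 2 ^ L
    ident<2^L v = <-≤-trans (toℕ<n (combine (proj₂ v) (proj₁ v))) ids<2^L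

    ident-injective : ∀ {u v} → ident u ≡ ident v → u ≡ v
    ident-injective {i , a} {j , b} eq with combine-injective a i b j (toℕ-injective eq)
    ... | refl , refl = refl

    -- The position of a vertex in its class, read in the mixed radix (m, 7, m, m, ∞), gives a slack
    -- digit, a type, two palette colours and the index of the bit on which it chooses between them.
    code : Vertex → ℕ
    code v = toℕ (proj₂ v) / m

    type : Vertex → Fin 7
    type v = code v mod 7

    palette₀ palette₁ : Vertex → Fin m
    palette₀ v = (code v / 7) mod m
    palette₁ v = (code v / 7 / m) mod m

    bitIndex : Vertex → ℕ
    bitIndex v = code v / 7 / m / m

    select : Vertex → ℕ → Fin m
    select w x = if bit (bitIndex w) x then palette₁ w else palette₀ w

    colourBy : Bool → Bool → Vertex → Vertex → Fin m
    colourBy true  _     u v = select u (ident v)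
    colourBy false true  u v = select v (ident u)
    colourBy false false _ _ = zero   -- equal types: any colour will do

    c : Vertex → Vertex → Fin m
    c u v = colourBy (dominates (type u) (type v)) (dominates (type v) (type u)) u v

    c-sym : ∀ u v → c u v ≡ c v u
    c-sym u v with dominates (type u) (type v) in u→v | dominates (type v) (type u) in v→u
    ... | true  | true  with () ← trans (sym (dominates-asym (type u) (type v) u→v)) v→u
    ... | true  | false = refl
    ... | false | true  = refl
    ... | false | false = refl

    colouring : Colouring G m
    colouring = c , c-sym

    c-dominated : ∀ w x → dominates (type w) (type x) ≡ true → c x w ≡ select w (ident x) × c w x ≡ select w (ident x)
    c-dominated w x w→x rewrite w→x | dominates-asym (type w) (type x) w→x = refl , refl

    encode : Fin 7 → Fin m → Fin m → ℕ → ℕ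
    encode y a₀ a₁ p = toℕ y + (toℕ a₀ + (toℕ a₁ + p * m) * m) * 7

    index<n : ∀ (y : Fin 7) (a₀ a₁ : Fin m) {p} → p < L → (z : Fin m) → toℕ z + encode y a₀ a₁ p * m < n
    index<n y a₀ a₁ p<L z = ≤-trans (digit< z (digit< y (digit< a₀ (digit< a₁ p<L)))) room

    candidate : Fin t → Fin 7 → Fin m → Fin m → (p : ℕ) → p < L → Fin m → Vertex
    candidate j y a₀ a₁ p p<L z = j , fromℕ< (index<n y a₀ a₁ p<L z)

    module _ (j : Fin t) (y : Fin 7) (a₀ a₁ : Fin m) (p : ℕ) (p<L : p < L) (z : Fin m) where

      private
        w : Vertex
        w = candidate j y a₀ a₁ p p<L z

        code≡ : code w ≡ encode y a₀ a₁ p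
        code≡ = trans (cong (_/ m) (toℕ-fromℕ< (index<n y a₀ a₁ p<L z))) (div-digit z (encode y a₀ a₁ p))

        /7≡ : code w / 7 ≡ toℕ a₀ + (toℕ a₁ + p * m) * m
        /7≡ = trans (cong (_/ 7) code≡) (div-digit y (toℕ a₀ + (toℕ a₁ + p * m) * m))

        /7/m≡ : code w / 7 / m ≡ toℕ a₁ + p * m
        /7/m≡ = trans (cong (_/ m) /7≡) (div-digit a₀ (toℕ a₁ + p * m))

        select≡ : ∀ x → select w x ≡ (if bit p x then a₁ else a₀)
        select≡ x = cong₂ (λ q a → if bit q x then proj₂ a else proj₁ a)
                      (trans (cong (_/ m) /7/m≡) (div-digit a₁ p))
                      (cong₂ _,_ (trans (cong (_mod m) /7≡) (mod-digit a₀ (toℕ a₁ + p * m)))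
                                 (trans (cong (_mod m) /7/m≡) (mod-digit a₁ p)))

      c-candidate : ∀ x → dominates y (type x) ≡ true →
                    c x w ≡ (if bit p (ident x) then a₁ else a₀) × c w x ≡ (if bit p (ident x) then a₁ else a₀)
      c-candidate x y→x =
        let c[x,w] , c[w,x] = c-dominated w x (subst (λ q → dominates q (type x) ≡ true) (sym type≡) y→x)
        in trans c[x,w] (select≡ (ident x)) , trans c[w,x] (select≡ (ident x))
        where
        type≡ : type w ≡ y
        type≡ = trans (cong (_mod 7) code≡) (mod-digit y (toℕ a₀ + (toℕ a₁ + p * m) * m))

    candidate-injective : ∀ j y a₀ a₁ p p<L {z z′} →
                          candidate j y a₀ a₁ p p<L z ≡ candidate j y a₀ a₁ p p<L z′ → z ≡ z′
    candidate-injective j y a₀ a₁ p p<L {z} {z′} eq =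
      trans (sym (slack z)) (trans (cong (λ v → toℕ (proj₂ v) mod m) eq) (slack z′))
      where
      slack : ∀ z → toℕ (proj₂ (candidate j y a₀ a₁ p p<L z)) mod m ≡ z
      slack z = trans (cong (_mod m) (toℕ-fromℕ< (index<n y a₀ a₁ p<L z))) (mod-digit z (encode y a₀ a₁ p))

    candidate-avoiding : ∀ j y a₀ a₁ p p<L (F : List Vertex) → length F < m →
                         ∃ λ z → candidate j y a₀ a₁ p p<L z ∉ F
    candidate-avoiding j y a₀ a₁ p p<L F |F|<m
      with ∃∉-of-longer (≡-dec Fin._≟_ Fin._≟_) F
             (Unique.map⁺ (candidate-injective j y a₀ a₁ p p<L) (Unique.allFin⁺ m))
             (subst (length F <_) (sym (trans (length-map _ (allFin m)) (length-allFin m))) |F|<m)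
    ... | w , w∈ , w∉F with ∈-map⁻ (candidate j y a₀ a₁ p p<L) w∈
    ...   | z , _ , refl = z , w∉F

    connector : ∀ s s′ j p → p < L → ∀ a₀ a₁ (F : List Vertex) → length F < m →
                ∃ λ w → class w ≡ j × w ∉ F × c s w ≡ (if bit p (ident s) then a₁ else a₀)
                                            × c w s′ ≡ (if bit p (ident s′) then a₁ else a₀)
    connector s s′ j p p<L a₀ a₁ F |F|<m =
      let y , y→s , y→s′ = commonDominator (type s) (type s′)
          z , w∉F = candidate-avoiding j y a₀ a₁ p p<L F |F|<m
      in candidate j y a₀ a₁ p p<L z , refl , w∉F ,
         proj₁ (c-candidate j y a₀ a₁ p p<L z s y→s) , proj₂ (c-candidate j y a₀ a₁ p p<L z s′ y→s′)

    extendable : Extendable colouring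
    extendable {s} {s′} s≢s′ j α β F |F|<m =
      let p , p<L , bits≢ = bits-separate L (ident<2^L s) (ident<2^L s′) (s≢s′ ∘ ident-injective)
          a₀ , a₁ , chosen≡α , chosen≡β = if-split α β bits≢
          w , w∈j , w∉F , c[s,w] , c[w,s′] = connector s s′ j p p<L a₀ a₁ F |F|<m
      in w , w∈j , w∉F , trans c[s,w] chosen≡α , trans c[w,s′] chosen≡β

  rainbowColouring : ∀ L → n * t ≤ 2 ^ L → L * m * m * 7 * m ≤ n → Σ (Colouring G m) (KRainbowCyclic G k)
  rainbowColouring L ids<2^L room = colouring , Threading.rainbowCyclic colouring extendable
    where open TournamentColouring L ids<2^L room

crx-balanced : ∀ k t → 2 ≤ k → 2 ≤ t → ∃ λ N → ∀ n → N ≤ n → CrxIs (completeBalanced t n) k (2 * k)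
crx-balanced 0 _ () _
crx-balanced 1 _ (s≤s ()) _
crx-balanced (suc (suc _)) 0 _ ()
crx-balanced (suc (suc _)) 1 _ (s≤s ())
crx-balanced k@(suc (suc k-2)) t@(suc (suc t-2)) _ _ =
  let N , large = ∃-bitLength (m * m * 7 * m) t
  in N + k , λ n N+k≤n →
       let L , ids<2^L , room = large n (≤-trans (m≤m+n N k) N+k≤n)
       in Balanced.rainbowColouring t-2 k-2 n L ids<2^L (subst (_≤ n) (reassoc L m) room) ,
          2k≤crx-balanced (≤-trans (m≤n+m k N) N+k≤n)
  where
  m : ℕ
  m = 2 * k
  reassoc : ∀ L m → L * (m * m * 7 * m) ≡ L * m * m * 7 * m
  reassoc = solve-∀

theorem3p4 : (∀ (t : ℕ) (n : Fin t → ℕ) → 3 ≤ t → (∀ i → 1 ≤ n i) →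
    (∀ i j → i ≤ᶠ j → n i ≤ n j) →
    CrxIs (completeMultipartite t n) 1 3)
    ×
    (∀ (k t : ℕ) → 2 ≤ k → 2 ≤ t →
    ∃ λ (N : ℕ) → ∀ (n : ℕ) → N ≤ n → CrxIs (completeBalanced t n) k (2 * k))
theorem3p4 = (λ t n 3≤t n≥1 _ → crx₁-multipartite t n 3≤t n≥1) , crx-balanced
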